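{- Let $m\ge 0$ and $k\ge 2$ be integers and $n=2^m$ with $n\ge k-1$. Then there exists a partition of $\binom{[n]}{k-1}$ (the set of all $(k-1)$-subsets of $[n]=\{1,\dots,n\}$) into $F(n,k-1)\le (\log_2 n)^{k-2}=m^{k-2}$ classes such that every class, viewed as a $(k-1)$-uniform hypergraph on $[n]$, covers $[n]$ (the union of its members is $[n]$) and contains no semicycle of length at most $k$.
   Context: For $r\ge 2$, an $r$-uniform hypergraph (a finite vertex set with a set of $r$-element subsets as edges) is a semicycle if there is a sequence $v_1,\dots,v_l$ of its vertices in which every vertex appears at least once (possibly more times), $v_1=v_l$, and its edge set consists of exactly the $l-r+1$ distinct sets $\{v_i,\dots,v_{i+r-1}\}$, $1\le i\le l-r+1$; its length is its number of edges. A hypergraph contains a semicycle if some subhypergraph of it is a semicycle. For $r=1$, a 1-uniform semicycle of length $t\ge 3$ is the 1-uniform (multi)hypergraph with vertex set $\{x_1,\dots,x_{t-1}\}$ and edge multiset consisting of $\{x_1\}$ with multiplicity 2 and $\{x_2\},\dots,\{x_{t-1}\}$. Convention: $0^0=1$. -}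

module Defs where

open import Data.Nat using (ℕ; zero; suc; _+_; _∸_; _≤_; _<_)
open import Data.Fin using (Fin; zero; suc)
open import Data.Fin.Subset using (Subset; ⁅_⁆; _∪_; ⊥; ∣_∣)
open import Data.Product using (Σ; _×_)
open import Relation.Binary.PropositionalEquality using (_≡_)

Hypergraph : ℕ → Set₁
Hypergraph n = Subset n → Set

window : ∀ {n} → (ℕ → Fin n) → ℕ → ℕ → Subset n
window v i zero    = ⊥
window v i (suc r) = ⁅ v i ⁆ ∪ window v (suc i) r

-- Sequence v 0 … v (l-1) with l = t + r - 1 (so there are t windows),
-- v 0 = v (l-1), each window is an r-set which is an edge of H, and the
-- t windows are pairwise distinct (so the edge set has exactly t edges).
ContainsSemicycleGe2 : ∀ {n} → ℕ → Hypergraph n → ℕ → Set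
ContainsSemicycleGe2 {n} r H t =
  Σ (ℕ → Fin n) λ v →
    (1 ≤ t) ×
    (v 0 ≡ v (t + r ∸ 2)) ×
    (∀ i → i < t → ∣ window v i r ∣ ≡ r) ×
    (∀ i → i < t → H (window v i r)) ×
    (∀ i j → i < t → j < t → window v i r ≡ window v j r → i ≡ j)

-- r = 1: the 1-uniform semicycle of length t = s + 3 has vertices
-- x_0, …, x_{s+1} (distinct) and edge multiset {x_0},{x_0},{x_1},…,{x_{s+1}}.
-- Edge i of the multiset is the singleton of x (lab i).
lab : ∀ {s} → Fin (suc (suc (suc s))) → Fin (suc (suc s))
lab zero    = zero
lab (suc i) = i

-- H contains it if there is an injective map from the edge multiset into
-- the edges of H sending each edge to an equal edge of H.
ContainsSemicycle1 : ∀ {n} → Hypergraph n → ℕ → Set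
ContainsSemicycle1 H zero = Fin 0
ContainsSemicycle1 H (suc zero) = Fin 0
ContainsSemicycle1 H (suc (suc zero)) = Fin 0
ContainsSemicycle1 {n} H (suc (suc (suc s))) =
  Σ (Fin (suc (suc s)) → Fin n) λ x →
  Σ (Fin (suc (suc (suc s))) → Subset n) λ e →
    (∀ a b → x a ≡ x b → a ≡ b) ×
    (∀ i j → e i ≡ e j → i ≡ j) ×
    (∀ i → H (e i)) ×
    (∀ i → e i ≡ ⁅ x (lab i) ⁆)

ContainsSemicycle : ∀ {n} → (r : ℕ) → Hypergraph n → ℕ → Set
ContainsSemicycle zero          H t = Fin 0
ContainsSemicycle (suc zero)    H t = ContainsSemicycle1 H t
ContainsSemicycle (suc (suc r)) H t = ContainsSemicycleGe2 (suc (suc r)) H t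

Class : ∀ {n c} → ℕ → (Subset n → Fin c) → Fin c → Hypergraph n
Class {n} r col j s = (∣ s ∣ ≡ r) × (col s ≡ j)

module Submission where

-- Let r = s + 1 = k - 1.  Every class j of the partition comes with a labelling of the
-- vertices by r colours that is injective ("rainbow") on each member of j.  Such classes
-- have no short semicycles: an r-uniform hypergraph whose edges are all rainbow for one
-- r-colouring has no semicycle of length ≤ r + 1, since r + 1 consecutive positions of the
-- vertex sequence repeat a colour while any two of them lie in a common edge.
--
-- The classes are built by recursion on m, doubling the vertex set Fin (V m), V m = 2^m.
-- A set inside one half belongs to the class it forms there one level down (coloured by the
-- old labelling on both halves); a set meeting both halves in a + 1 and b + 1 vertices
-- belongs to the split class given by a and the classes of its two parts, coloured with
-- disjoint palettes of sizes a + 1 and b + 1.  Thus classes (m+1) s = classes m s +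
-- Σ_a classes m a · classes m (s-1-a) ≤ m^s + s m^(s-1) ≤ (m+1)^s.

open import Defs
open import Data.Nat using (ℕ; zero; suc; _+_; _*_; _∸_; _^_; _≤_; _<_; _≟_; z≤n; s≤s)
open import Data.Nat.Properties
open import Data.Nat.Solver using (module +-*-Solver)
open import Data.Fin using (Fin; zero; suc; toℕ; fromℕ<; _↑ˡ_; _↑ʳ_; splitAt; cast; combine; remQuot)
import Data.Fin.Properties as FinP
open import Data.Fin.Subset using (Subset; _∈_; ∣_∣; ⁅_⁆; _∪_; ⊥; inside; outside)
open import Data.Fin.Subset.Properties
  using ( x∈p∪q⁺; x∈p∪q⁻; x∈⁅x⁆; x∈⁅y⁆⇒x≡y; ∉⊥; ∣⊥∣≡0; ∣⁅x⁆∣≡1; p⊆q⇒∣p∣≤∣q∣; ∣p∣≤∣x∷p∣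
        ; ∪-comm; ∪-assoc; ∪-identityˡ; ∪-identityʳ)
open import Data.Vec as Vec using ([]; _∷_; _++_)
open import Data.Vec.Properties
  using (lookup-++ˡ; lookup-++ʳ; []=⇒lookup; lookup⇒[]=; ++-injective; ++-injectiveˡ; ++-injectiveʳ)
open import Data.Product using (Σ; _×_; _,_; proj₁; proj₂; map; uncurry)
open import Data.Sum using (inj₁; inj₂; [_,_]′)
open import Data.Empty using (⊥-elim)
open import Function using (id; _∘_)
open import Relation.Nullary using (¬_; yes; no)
open import Relation.Binary.PropositionalEquality
  using (_≡_; _≢_; refl; sym; trans; cong; cong₂; subst; module ≡-Reasoning)

Rainbow : ∀ {n r} → (Fin n → Fin r) → Subset n → Set
Rainbow L S = ∀ {x y} → x ∈ S → y ∈ S → L x ≡ L y → x ≡ y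

∣p∪q∣≤∣p∣+∣q∣ : ∀ {n} (p q : Subset n) → ∣ p ∪ q ∣ ≤ ∣ p ∣ + ∣ q ∣
∣p∪q∣≤∣p∣+∣q∣ []            []            = z≤n
∣p∪q∣≤∣p∣+∣q∣ (outside ∷ p) (outside ∷ q) = ∣p∪q∣≤∣p∣+∣q∣ p q
∣p∪q∣≤∣p∣+∣q∣ (outside ∷ p) (inside ∷ q)  =
  subst (suc ∣ p ∪ q ∣ ≤_) (sym (+-suc ∣ p ∣ ∣ q ∣)) (s≤s (∣p∪q∣≤∣p∣+∣q∣ p q))
∣p∪q∣≤∣p∣+∣q∣ (inside ∷ p)  (b ∷ q)       =
  s≤s (≤-trans (∣p∪q∣≤∣p∣+∣q∣ p q) (+-monoʳ-≤ ∣ p ∣ (∣p∣≤∣x∷p∣ b q)))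

∣⁅x⁆∪p∣≤∣p∣ : ∀ {n} (x : Fin n) (p : Subset n) → x ∈ p → ∣ ⁅ x ⁆ ∪ p ∣ ≤ ∣ p ∣
∣⁅x⁆∪p∣≤∣p∣ x p x∈p = p⊆q⇒∣p∣≤∣q∣ λ y∈ →
  [ (λ y∈⁅x⁆ → subst (_∈ p) (sym (x∈⁅y⁆⇒x≡y x y∈⁅x⁆)) x∈p) , id ]′ (x∈p∪q⁻ ⁅ x ⁆ p y∈)

∈-window : ∀ {n} (v : ℕ → Fin n) i r a → a < r → v (i + a) ∈ window v i r
∈-window v i (suc r) zero    _         =
  x∈p∪q⁺ (inj₁ (subst (λ z → v z ∈ ⁅ v i ⁆) (sym (+-identityʳ i)) (x∈⁅x⁆ (v i))))
∈-window v i (suc r) (suc a) (s≤s a<r) =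
  x∈p∪q⁺ {p = ⁅ v i ⁆}
    (inj₂ (subst (λ z → v z ∈ window v (suc i) r) (sym (+-suc i a)) (∈-window v (suc i) r a a<r)))

∣window∣≤ : ∀ {n} (v : ℕ → Fin n) i r → ∣ window v i r ∣ ≤ r
∣window∣≤ {n} v i zero    = ≤-reflexive (∣⊥∣≡0 n)
∣window∣≤     v i (suc r) = ≤-trans (∣p∪q∣≤∣p∣+∣q∣ ⁅ v i ⁆ (window v (suc i) r))
  (subst (λ z → z + ∣ window v (suc i) r ∣ ≤ suc r) (sym (∣⁅x⁆∣≡1 (v i))) (s≤s (∣window∣≤ v (suc i) r)))

window-repeat : ∀ {n} (v : ℕ → Fin n) r i a b → a < b → b < r →
  v (i + a) ≡ v (i + b) → ∣ window v i r ∣ < r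
window-repeat v (suc r) i zero (suc b) _ (s≤s b<r) eq = s≤s (≤-trans
  (∣⁅x⁆∪p∣≤∣p∣ (v i) (window v (suc i) r) (subst (_∈ window v (suc i) r) repeated (∈-window v (suc i) r b b<r)))
  (∣window∣≤ v (suc i) r))
  where
  repeated : v (suc i + b) ≡ v i
  repeated = trans (cong v (sym (+-suc i b))) (trans (sym eq) (cong v (+-identityʳ i)))
window-repeat v (suc r) i (suc a) (suc b) (s≤s a<b) (s≤s b<r) eq = ≤-trans
  (s≤s (∣p∪q∣≤∣p∣+∣q∣ ⁅ v i ⁆ (window v (suc i) r)))
  (subst (λ z → suc (z + ∣ window v (suc i) r ∣) ≤ suc r) (sym (∣⁅x⁆∣≡1 (v i)))
    (s≤s (window-repeat v r (suc i) a b a<b b<r shifted)))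
  where
  shifted : v (suc i + a) ≡ v (suc i + b)
  shifted = trans (cong v (sym (+-suc i a))) (trans eq (cong v (+-suc i b)))

window-snoc : ∀ {n} (v : ℕ → Fin n) i r → window v i (suc r) ≡ window v i r ∪ ⁅ v (i + r) ⁆
window-snoc v i zero    = trans (∪-identityʳ _)
  (trans (cong (λ z → ⁅ v z ⁆) (sym (+-identityʳ i))) (sym (∪-identityˡ _)))
window-snoc v i (suc r) = trans (cong (⁅ v i ⁆ ∪_) (window-snoc v (suc i) r))
  (trans (sym (∪-assoc ⁅ v i ⁆ (window v (suc i) r) _))
    (cong (λ z → window v i (suc r) ∪ ⁅ v z ⁆) (sym (+-suc i r))))

module _ {n q} (H : Hypergraph n) (L : Fin n → Fin (suc (suc q)))
         (rainbow : ∀ S → H S → Rainbow L S) where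

  private
    r : ℕ
    r = suc (suc q)

  window-labels-distinct : ∀ (v : ℕ → Fin n) i → ∣ window v i r ∣ ≡ r → H (window v i r) →
    ∀ a b → a < b → b < r → L (v (i + a)) ≢ L (v (i + b))
  window-labels-distinct v i size edge a b a<b b<r eq = <-irrefl size
    (window-repeat v r i a b a<b b<r
      (rainbow _ edge (∈-window v i r a (<-trans a<b b<r)) (∈-window v i r b b<r) eq))

  -- Length 1: the closing vertex repeats inside the single window.  Length 2: the two
  -- windows coincide.  Length t = u + 3 ≤ r + 1: the r + 1 positions u+1, …, u+1+r carry
  -- only r labels, and every pair of them lies in a common window (wrapping to window 0
  -- through v 0 = v (u+1+r)).
  no-short-semicycle≥2 : ∀ t → t ≤ suc r → ¬ ContainsSemicycleGe2 r H t
  no-short-semicycle≥2 zero _ (_ , () , _)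
  no-short-semicycle≥2 (suc zero) _ (v , _ , closed , size , edge , _) =
    window-labels-distinct v 0 (size 0 (s≤s z≤n)) (edge 0 (s≤s z≤n)) 0 (suc q) (s≤s z≤n) ≤-refl (cong L closed)
  no-short-semicycle≥2 (suc (suc zero)) _ (v , _ , closed , _ , _ , distinct) =
    0≢1 (distinct 0 1 (s≤s z≤n) (s≤s (s≤s z≤n)) windows-equal)
    where
    open ≡-Reasoning
    0≢1 : 0 ≢ 1
    0≢1 ()
    windows-equal : window v 0 r ≡ window v 1 r
    windows-equal = begin
      ⁅ v 0 ⁆ ∪ window v 1 (suc q) ≡⟨ cong (λ z → ⁅ z ⁆ ∪ window v 1 (suc q)) closed ⟩
      ⁅ v r ⁆ ∪ window v 1 (suc q) ≡⟨ ∪-comm _ _ ⟩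
      window v 1 (suc q) ∪ ⁅ v r ⁆ ≡⟨ sym (window-snoc v 1 (suc q)) ⟩
      window v 1 r                 ∎
  no-short-semicycle≥2 (suc (suc (suc u))) (s≤s (s≤s (s≤s u≤q))) (v , _ , closed , size , edge , _)
    with FinP.pigeonhole (n<1+n r) (λ a → L (v (suc u + toℕ a)))
  ... | a , b , a<b , eq = collision (toℕ a) (toℕ b) a<b (FinP.toℕ≤pred[n] b) eq
    where
    t : ℕ
    t = suc (suc (suc u))
    distinct-in : ∀ i → i < t → ∀ a b → a < b → b < r → L (v (i + a)) ≢ L (v (i + b))
    distinct-in i i<t = window-labels-distinct v i (size i i<t) (edge i i<t)
    collision : ∀ a b → a < b → b ≤ r → L (v (suc u + a)) ≢ L (v (suc u + b))
    collision a b a<b b≤r with m≤n⇒m<n∨m≡n b≤r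
    ... | inj₁ b<r = distinct-in (suc u) (s≤s (n≤1+n _)) a b a<b b<r
    collision zero    .r _ _ | inj₂ refl = λ eq → distinct-in 0 (s≤s z≤n) 0 (suc u) (s≤s z≤n) (s≤s (s≤s u≤q))
      (trans (cong L closed) (trans (sym eq) (cong (λ z → L (v z)) (+-identityʳ (suc u)))))
    collision (suc a) .r (s≤s a<b) _ | inj₂ refl = λ eq → distinct-in (suc (suc u)) (n<1+n _) a (suc q) a<b ≤-refl
      (trans (cong (λ z → L (v z)) (sym (+-suc (suc u) a)))
             (trans eq (cong (λ z → L (v z)) (+-suc (suc u) (suc q)))))

rainbow⇒no-short-semicycle : ∀ {n} r (H : Hypergraph n) (L : Fin n → Fin r) →
  (∀ S → H S → Rainbow L S) → ∀ t → t ≤ suc r → ¬ ContainsSemicycle r H t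
rainbow⇒no-short-semicycle zero          H L rainbow t                   _ ()
rainbow⇒no-short-semicycle (suc zero)    H L rainbow zero                _ ()
rainbow⇒no-short-semicycle (suc zero)    H L rainbow (suc zero)          _ ()
rainbow⇒no-short-semicycle (suc zero)    H L rainbow (suc (suc zero))    _ ()
rainbow⇒no-short-semicycle (suc zero)    H L rainbow (suc (suc (suc t))) (s≤s (s≤s ()))
rainbow⇒no-short-semicycle (suc (suc q)) H L rainbow t                   t≤ = no-short-semicycle≥2 H L rainbow t t≤

∑ : ∀ n → (Fin n → ℕ) → ℕ
∑ zero    g = 0
∑ (suc n) g = g zero + ∑ n (g ∘ suc)

∑-≤ : ∀ {n c} (g : Fin n → ℕ) → (∀ i → g i ≤ c) → ∑ n g ≤ n * c
∑-≤ {zero}  g g≤c = z≤n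
∑-≤ {suc n} g g≤c = +-mono-≤ (g≤c zero) (∑-≤ (g ∘ suc) (g≤c ∘ suc))

∑-inject : ∀ {n} (g : Fin n → ℕ) (i : Fin n) → Fin (g i) → Fin (∑ n g)
∑-inject {suc n} g zero    k = k ↑ˡ ∑ n (g ∘ suc)
∑-inject {suc n} g (suc i) k = g zero ↑ʳ ∑-inject (g ∘ suc) i k

∑-split : ∀ {n} (g : Fin n → ℕ) → Fin (∑ n g) → Σ (Fin n) (Fin ∘ g)
∑-split {suc n} g k = [ (zero ,_) , map suc id ∘ ∑-split (g ∘ suc) ]′ (splitAt (g zero) k)

∑-split-inject : ∀ {n} (g : Fin n → ℕ) i k → ∑-split g (∑-inject g i k) ≡ (i , k)
∑-split-inject {suc n} g zero    k rewrite FinP.splitAt-↑ˡ (g zero) k (∑ n (g ∘ suc)) = refl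
∑-split-inject {suc n} g (suc i) k
  rewrite FinP.splitAt-↑ʳ (g zero) (∑ n (g ∘ suc)) (∑-inject (g ∘ suc) i k)
        | ∑-split-inject (g ∘ suc) i k = refl

∑-inject-split : ∀ {n} (g : Fin n → ℕ) k → uncurry (∑-inject g) (∑-split g k) ≡ k
∑-inject-split {suc n} g k with splitAt (g zero) k in eq
... | inj₁ k′ = FinP.splitAt⁻¹-↑ˡ eq
... | inj₂ k′ = trans (cong (g zero ↑ʳ_) (∑-inject-split (g ∘ suc) k′)) (FinP.splitAt⁻¹-↑ʳ eq)

data Half {N M : ℕ} : Fin (N + M) → Set where
  inLeft  : (x : Fin N) → Half (x ↑ˡ M)
  inRight : (y : Fin M) → Half (N ↑ʳ y)

half : ∀ {N M} (z : Fin (N + M)) → Half z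
half {N} z with splitAt N z in eq
... | inj₁ x = subst Half (FinP.splitAt⁻¹-↑ˡ eq) (inLeft x)
... | inj₂ y = subst Half (FinP.splitAt⁻¹-↑ʳ eq) (inRight y)

∈-++ˡ : ∀ {N M} {p : Subset N} (q : Subset M) {x} → x ∈ p → x ↑ˡ M ∈ p ++ q
∈-++ˡ {p = p} q {x} x∈p = lookup⇒[]= _ _ (trans (lookup-++ˡ p q x) ([]=⇒lookup x∈p))

∈-++ʳ : ∀ {N M} (p : Subset N) {q : Subset M} {y} → y ∈ q → N ↑ʳ y ∈ p ++ q
∈-++ʳ p {q} {y} y∈q = lookup⇒[]= _ _ (trans (lookup-++ʳ p q y) ([]=⇒lookup y∈q))

∈-++ˡ⁻ : ∀ {N M} (p : Subset N) (q : Subset M) {x} → x ↑ˡ M ∈ p ++ q → x ∈ p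
∈-++ˡ⁻ p q {x} x∈ = lookup⇒[]= x p (trans (sym (lookup-++ˡ p q x)) ([]=⇒lookup x∈))

∈-++ʳ⁻ : ∀ {N M} (p : Subset N) (q : Subset M) {y} → N ↑ʳ y ∈ p ++ q → y ∈ q
∈-++ʳ⁻ p q {y} y∈ = lookup⇒[]= y q (trans (sym (lookup-++ʳ p q y)) ([]=⇒lookup y∈))

∣p++q∣ : ∀ {N M} (p : Subset N) (q : Subset M) → ∣ p ++ q ∣ ≡ ∣ p ∣ + ∣ q ∣
∣p++q∣ []            q = refl
∣p++q∣ (outside ∷ p) q = ∣p++q∣ p q
∣p++q∣ (inside ∷ p)  q = cong suc (∣p++q∣ p q)

∣p++⊥∣ : ∀ {N} M (p : Subset N) → ∣ p ++ ⊥ {M} ∣ ≡ ∣ p ∣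
∣p++⊥∣ M p = trans (∣p++q∣ p ⊥) (trans (cong (∣ p ∣ +_) (∣⊥∣≡0 M)) (+-identityʳ ∣ p ∣))

∣⊥++q∣ : ∀ N {M} (q : Subset M) → ∣ ⊥ {N} ++ q ∣ ≡ ∣ q ∣
∣⊥++q∣ N q = trans (∣p++q∣ (⊥ {N}) q) (cong (_+ ∣ q ∣) (∣⊥∣≡0 N))

∣p∣≡0⇒p≡⊥ : ∀ {n} (p : Subset n) → ∣ p ∣ ≡ 0 → p ≡ ⊥
∣p∣≡0⇒p≡⊥ []            _ = refl
∣p∣≡0⇒p≡⊥ (outside ∷ p) e = cong (outside ∷_) (∣p∣≡0⇒p≡⊥ p e)
∣p∣≡0⇒p≡⊥ (inside ∷ p)  ()

data Parts {N : ℕ} : Subset N → Subset N → Set where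
  leftOnly  : ∀ p → Parts p ⊥
  rightOnly : ∀ q → Parts ⊥ q
  meetsBoth : ∀ {p q} a b → ∣ p ∣ ≡ suc a → ∣ q ∣ ≡ suc b → Parts p q

parts : ∀ {N} (p q : Subset N) → Parts p q
parts p q with ∣ q ∣ in q-size
... | zero = subst (Parts p) (sym (∣p∣≡0⇒p≡⊥ q q-size)) (leftOnly p)
... | suc b with ∣ p ∣ in p-size
...   | zero  = subst (λ p′ → Parts p′ q) (sym (∣p∣≡0⇒p≡⊥ p p-size)) (rightOnly q)
...   | suc a = meetsBoth a b p-size q-size

subsetOfSize : ∀ {n} r → r ≤ n → Σ (Subset n) λ S → ∣ S ∣ ≡ r
subsetOfSize {n} zero    _         = ⊥ , ∣⊥∣≡0 n
subsetOfSize     (suc r) (s≤s r≤n) = let (S , size) = subsetOfSize r r≤n in inside ∷ S , cong suc size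

byParts : ∀ {N M r} → (Fin N → Fin r) → (Fin M → Fin r) → Fin (N + M) → Fin r
byParts {N} f g z = [ f , g ]′ (splitAt N z)

byParts-↑ˡ : ∀ {N M r} (f : Fin N → Fin r) (g : Fin M → Fin r) x → byParts f g (x ↑ˡ M) ≡ f x
byParts-↑ˡ {N} {M} f g x = cong [ f , g ]′ (FinP.splitAt-↑ˡ N x M)

byParts-↑ʳ : ∀ {N M r} (f : Fin N → Fin r) (g : Fin M → Fin r) y → byParts f g (N ↑ʳ y) ≡ g y
byParts-↑ʳ {N} {M} f g y = cong [ f , g ]′ (FinP.splitAt-↑ʳ N M y)

rainbow-byParts : ∀ {N M r} {f : Fin N → Fin r} {g : Fin M → Fin r} {p : Subset N} {q : Subset M} →
  Rainbow f p → Rainbow g q → (∀ {x y} → x ∈ p → y ∈ q → f x ≢ g y) →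
  Rainbow (byParts f g) (p ++ q)
rainbow-byParts {N} {M} {f = f} {g} {p} {q} rf rg apart {x} {y} x∈ y∈ eq with half {N} {M} x | half {N} {M} y
... | inLeft x′  | inLeft y′  = cong (_↑ˡ M) (rf (∈-++ˡ⁻ p q x∈) (∈-++ˡ⁻ p q y∈)
  (trans (sym (byParts-↑ˡ f g x′)) (trans eq (byParts-↑ˡ f g y′))))
... | inRight x′ | inRight y′ = cong (N ↑ʳ_) (rg (∈-++ʳ⁻ p q x∈) (∈-++ʳ⁻ p q y∈)
  (trans (sym (byParts-↑ʳ f g x′)) (trans eq (byParts-↑ʳ f g y′))))
... | inLeft x′  | inRight y′ = ⊥-elim (apart (∈-++ˡ⁻ p q x∈) (∈-++ʳ⁻ p q y∈)
  (trans (sym (byParts-↑ˡ f g x′)) (trans eq (byParts-↑ʳ f g y′))))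
... | inRight x′ | inLeft y′  = ⊥-elim (apart (∈-++ˡ⁻ p q y∈) (∈-++ʳ⁻ p q x∈)
  (trans (sym (byParts-↑ˡ f g y′)) (trans (sym eq) (byParts-↑ʳ f g x′))))

rainbow-⊥ : ∀ {n r} {L : Fin n → Fin r} → Rainbow L ⊥
rainbow-⊥ x∈ = ⊥-elim (∉⊥ x∈)

rainbow-∘ : ∀ {n r r′} {L : Fin n → Fin r} {S} (h : Fin r → Fin r′) →
  (∀ {a b} → h a ≡ h b → a ≡ b) → Rainbow L S → Rainbow (h ∘ L) S
rainbow-∘ h h-injective rL x∈ y∈ eq = rL x∈ y∈ (h-injective eq)

cast-injective : ∀ {a b} .(e : a ≡ b) {x y : Fin a} → cast e x ≡ cast e y → x ≡ y
cast-injective e {x} {y} eq =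
  FinP.toℕ-injective (trans (sym (FinP.toℕ-cast e x)) (trans (cong toℕ eq) (FinP.toℕ-cast e y)))

↑ˡ≢↑ʳ : ∀ {a b} (x : Fin a) (y : Fin b) → x ↑ˡ b ≢ a ↑ʳ y
↑ˡ≢↑ʳ {a} {b} x y eq with trans (sym (FinP.splitAt-↑ˡ a x b)) (trans (cong (splitAt a) eq) (FinP.splitAt-↑ʳ a b y))
... | ()

V : ℕ → ℕ
V zero    = 1
V (suc m) = V m + V m

-- For i : Fin s, a split (s+1)-set has toℕ i + 1 vertices in the left half and
-- rest i + 1 in the right half.
rest : ∀ {s} → Fin s → ℕ
rest {s} i = s ∸ suc (toℕ i)

rest-sum : ∀ {q} (i : Fin (suc q)) → toℕ i + rest i ≡ q
rest-sum i = m+[n∸m]≡n (FinP.toℕ≤pred[n] i)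

split-size : ∀ {s} (i : Fin s) → suc (toℕ i) + suc (rest i) ≡ suc s
split-size {suc q} i = cong suc (trans (+-suc (toℕ i) (rest i)) (cong suc (rest-sum i)))

split-index : ∀ {s} a b → suc a + suc b ≡ suc s → Σ (Fin s) λ i → (toℕ i ≡ a) × (rest i ≡ b)
split-index {s} a b e = i , toℕ-i , suc-injective (+-cancelˡ-≡ (suc a) _ _ sizes)
  where
  open ≡-Reasoning
  a<s : a < s
  a<s = subst (a <_) (suc-injective e) (m<m+n a (s≤s z≤n))
  i : Fin s
  i = fromℕ< a<s
  toℕ-i : toℕ i ≡ a
  toℕ-i = FinP.toℕ-fromℕ< a<s
  sizes : suc a + suc (rest i) ≡ suc a + suc b
  sizes = begin
    suc a + suc (rest i)       ≡⟨ cong (λ t → suc t + suc (rest i)) (sym toℕ-i) ⟩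
    suc (toℕ i) + suc (rest i) ≡⟨ split-size i ⟩
    suc s                      ≡⟨ sym e ⟩
    suc a + suc b              ∎

-- Number of classes of (s+1)-subsets at level m: the classes of level m - 1 (kept, each
-- now containing sets from either half) plus one split class for every i : Fin s and
-- every pair of classes of the two parts.
mutual
  classes : ℕ → ℕ → ℕ
  classes zero    zero    = 1
  classes zero    (suc s) = 0
  classes (suc m) s       = classes m s + ∑ s (splitCount m s)

  splitCount : ∀ m s → Fin s → ℕ
  splitCount m s i = classes m (toℕ i) * classes m (rest i)

data Desc (m s : ℕ) : Set where
  kept  : Fin (classes m s) → Desc m s
  split : (i : Fin s) → Fin (classes m (toℕ i)) → Fin (classes m (rest i)) → Desc m s

encode : ∀ {m s} → Desc m s → Fin (classes (suc m) s)
encode {m} {s} (kept j)      = j ↑ˡ ∑ s (splitCount m s)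
encode {m} {s} (split i c d) = classes m s ↑ʳ ∑-inject (splitCount m s) i (combine c d)

decode : ∀ {m s} → Fin (classes (suc m) s) → Desc m s
decode {m} {s} j = [ kept , fromSplit ∘ ∑-split (splitCount m s) ]′ (splitAt (classes m s) j)
  where
  fromSplit : Σ (Fin s) (Fin ∘ splitCount m s) → Desc m s
  fromSplit (i , cd) = let (c , d) = remQuot (classes m (rest i)) cd in split i c d

decode-encode : ∀ {m s} (d : Desc m s) → decode (encode d) ≡ d
decode-encode {m} {s} (kept j) rewrite FinP.splitAt-↑ˡ (classes m s) j (∑ s (splitCount m s)) = refl
decode-encode {m} {s} (split i c d)
  rewrite FinP.splitAt-↑ʳ (classes m s) (∑ s (splitCount m s)) (∑-inject (splitCount m s) i (combine c d))
        | ∑-split-inject (splitCount m s) i (combine c d)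
        = cong (λ cd → split i (proj₁ cd) (proj₂ cd)) (FinP.remQuot-combine c d)

encode-decode : ∀ {m s} (j : Fin (classes (suc m) s)) → encode (decode {m} {s} j) ≡ j
encode-decode {m} {s} j with splitAt (classes m s) j in eq
... | inj₁ j′ = FinP.splitAt⁻¹-↑ˡ eq
... | inj₂ k  = trans (cong (classes m s ↑ʳ_) split-roundtrip) (FinP.splitAt⁻¹-↑ʳ eq)
  where
  i : Fin s
  i = proj₁ (∑-split (splitCount m s) k)
  cd : Fin (splitCount m s i)
  cd = proj₂ (∑-split (splitCount m s) k)
  split-roundtrip :
    ∑-inject (splitCount m s) i (uncurry combine (remQuot {classes m (toℕ i)} (classes m (rest i)) cd)) ≡ k
  split-roundtrip = trans (cong (∑-inject (splitCount m s) i) (FinP.combine-remQuot {classes m (toℕ i)} _ cd))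
                          (∑-inject-split (splitCount m s) k)

mutual
  label : ∀ m s → Fin (classes m s) → Fin (V m) → Fin (suc s)
  label zero    zero    _ _ = zero
  label zero    (suc s) ()
  label (suc m) s       j   = descLabel (decode {m} {s} j)

  descLabel : ∀ {m s} → Desc m s → Fin (V (suc m)) → Fin (suc s)
  descLabel {m} {s} (kept j)      = byParts (label m s j) (label m s j)
  descLabel {m} {s} (split i c d) = byParts
    (λ x → cast (split-size i) (label m (toℕ i) c x ↑ˡ suc (rest i)))
    (λ y → cast (split-size i) (suc (toℕ i) ↑ʳ label m (rest i) d y))

data InClass : ∀ m s → Subset (V m) → Fin (classes m s) → Set where
  base  : InClass zero zero ⁅ zero ⁆ zero
  left  : ∀ {m s p j} → InClass m s p j → InClass (suc m) s (p ++ ⊥) (encode {m} (kept j))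
  right : ∀ {m s q j} → InClass m s q j → InClass (suc m) s (⊥ ++ q) (encode {m} (kept j))
  both  : ∀ {m s p q} (i : Fin s) {c d} → InClass m (toℕ i) p c → InClass m (rest i) q d →
          InClass (suc m) s (p ++ q) (encode {m} (split i c d))

inClass-size : ∀ {m s S j} → InClass m s S j → ∣ S ∣ ≡ suc s
inClass-size base                     = refl
inClass-size {suc m} (left {p = p} h)  = trans (∣p++⊥∣ (V m) p) (inClass-size h)
inClass-size {suc m} (right {q = q} h) = trans (∣⊥++q∣ (V m) q) (inClass-size h)
inClass-size (both {p = p} {q} i hp hq) =
  trans (∣p++q∣ p q) (trans (cong₂ _+_ (inClass-size hp) (inClass-size hq)) (split-size i))

inClass-nonempty : ∀ {m s S j} → InClass m s S j → S ≢ ⊥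
inClass-nonempty {m} {S = S} h S≡⊥ with trans (sym (inClass-size h)) (trans (cong ∣_∣ S≡⊥) (∣⊥∣≡0 (V m)))
... | ()

rainbow-encode : ∀ {m s S} (d : Desc m s) → Rainbow (descLabel d) S → Rainbow (label (suc m) s (encode d)) S
rainbow-encode {m} {S = S} d = subst (λ L → Rainbow L S) (cong descLabel (sym (decode-encode {m} d)))

inClass-rainbow : ∀ {m s S j} → InClass m s S j → Rainbow (label m s j) S
inClass-rainbow base {zero} {zero} _ _ _ = refl
inClass-rainbow {suc m} (left {j = j} h) =
  rainbow-encode {m} (kept j) (rainbow-byParts (inClass-rainbow h) rainbow-⊥ λ _ y∈⊥ → ⊥-elim (∉⊥ y∈⊥))
inClass-rainbow {suc m} (right {j = j} h) =
  rainbow-encode {m} (kept j) (rainbow-byParts rainbow-⊥ (inClass-rainbow h) λ x∈⊥ _ → ⊥-elim (∉⊥ x∈⊥))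
inClass-rainbow {suc m} (both i {c} {d} hp hq) = rainbow-encode {m} (split i c d) (rainbow-byParts
  (rainbow-∘ (λ a → cast (split-size i) (a ↑ˡ suc (rest i)))
    (λ eq → FinP.↑ˡ-injective (suc (rest i)) _ _ (cast-injective (split-size i) eq)) (inClass-rainbow hp))
  (rainbow-∘ (λ b → cast (split-size i) (suc (toℕ i) ↑ʳ b))
    (λ eq → FinP.↑ʳ-injective (suc (toℕ i)) _ _ (cast-injective (split-size i) eq)) (inClass-rainbow hq))
  λ {x} {y} _ _ eq → ↑ˡ≢↑ʳ (label m (toℕ i) c x) (label m (rest i) d y) (cast-injective (split-size i) eq))

classify : ∀ m s (S : Subset (V m)) → ∣ S ∣ ≡ suc s → Σ (Fin (classes m s)) (InClass m s S)
classify zero    zero    (inside ∷ [])  _  = zero , base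
classify zero    zero    (outside ∷ []) ()
classify zero    (suc s) (inside ∷ [])  ()
classify zero    (suc s) (outside ∷ []) ()
classify (suc m) s       S              size with Vec.splitAt (V m) S
... | p , q , refl with parts p q
...   | leftOnly p =
  let (j , h) = classify m s p (trans (sym (∣p++⊥∣ (V m) p)) size) in encode {m} (kept j) , left h
...   | rightOnly q =
  let (j , h) = classify m s q (trans (sym (∣⊥++q∣ (V m) q)) size) in encode {m} (kept j) , right h
...   | meetsBoth a b p-size q-size =
  let sizes = trans (cong₂ _+_ (sym p-size) (sym q-size)) (trans (sym (∣p++q∣ p q)) size)
      (i , toℕ-i , rest-i) = split-index a b sizes
      (c , hp) = classify m (toℕ i) p (trans p-size (cong suc (sym toℕ-i)))
      (d , hq) = classify m (rest i) q (trans q-size (cong suc (sym rest-i)))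
  in encode {m} (split i c d) , both i hp hq

inClass-unique : ∀ {m s S S′ j j′} → InClass m s S j → InClass m s S′ j′ → S ≡ S′ → j ≡ j′
inClass-unique base base _ = refl
inClass-unique {suc m} (left {p = p} h) (left {p = p′} h′) e =
  cong (encode {m} ∘ kept) (inClass-unique h h′ (++-injectiveˡ p p′ e))
inClass-unique {suc m} (right h) (right h′) e =
  cong (encode {m} ∘ kept) (inClass-unique h h′ (++-injectiveʳ ⊥ ⊥ e))
inClass-unique (left {p = p} h) (right h′) e = ⊥-elim (inClass-nonempty h (++-injectiveˡ p ⊥ e))
inClass-unique (left {p = p} h) (both {p = p′} i hp hq) e =
  ⊥-elim (inClass-nonempty hq (sym (++-injectiveʳ p p′ e)))
inClass-unique (right h) (left {p = p} h′) e = ⊥-elim (inClass-nonempty h′ (sym (++-injectiveˡ ⊥ p e)))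
inClass-unique (right h) (both {p = p} i hp hq) e = ⊥-elim (inClass-nonempty hp (sym (++-injectiveˡ ⊥ p e)))
inClass-unique (both {p = p} i hp hq) (left {p = p′} h) e =
  ⊥-elim (inClass-nonempty hq (++-injectiveʳ p p′ e))
inClass-unique (both {p = p} i hp hq) (right h) e = ⊥-elim (inClass-nonempty hp (++-injectiveˡ p ⊥ e))
inClass-unique {suc m} (both {p = p} i hp hq) (both {p = p′} i′ hp′ hq′) e with ++-injective p p′ e
... | refl , refl with FinP.toℕ-injective (suc-injective (trans (sym (inClass-size hp)) (inClass-size hp′)))
...   | refl = cong₂ (λ c d → encode {m} (split i c d)) (inClass-unique hp hp′ refl) (inClass-unique hq hq′ refl)

cover : ∀ m s (j : Fin (classes m s)) (v : Fin (V m)) → Σ (Subset (V m)) λ S → InClass m s S j × v ∈ S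
cover zero    zero    zero zero = ⁅ zero ⁆ , base , x∈⁅x⁆ zero
cover zero    (suc s) ()
cover (suc m) s       j    v    =
  subst (λ j → Σ (Subset (V (suc m))) λ S → InClass (suc m) s S j × v ∈ S)
        (encode-decode {m} j) (cover-desc (decode {m} j) v)
  where
  cover-desc : (d : Desc m s) (w : Fin (V (suc m))) →
    Σ (Subset (V (suc m))) λ S → InClass (suc m) s S (encode d) × w ∈ S
  cover-desc (kept j) w with half {V m} {V m} w
  ... | inLeft x  = let (p , h , x∈p) = cover m s j x in p ++ ⊥ , left h , ∈-++ˡ ⊥ x∈p
  ... | inRight y = let (q , h , y∈q) = cover m s j y in ⊥ ++ q , right h , ∈-++ʳ ⊥ y∈q
  cover-desc (split i c d) w with half {V m} {V m} w
  ... | inLeft x  = let (p , hp , x∈p) = cover m (toℕ i) c x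
                        (q , hq , _)   = cover m (rest i) d x
                    in p ++ q , both i hp hq , ∈-++ˡ q x∈p
  ... | inRight y = let (p , hp , _)   = cover m (toℕ i) c y
                        (q , hq , y∈q) = cover m (rest i) d y
                    in p ++ q , both i hp hq , ∈-++ʳ p y∈q

-- (1 + m)^(q+1) ≥ m^(q+1) + (q+1) m^q: the first two terms of the binomial expansion.
binomial : ∀ m q → m ^ suc q + suc q * m ^ q ≤ suc m ^ suc q
binomial m zero    = ≤-reflexive (solve 1 (λ m → m :* con 1 :+ con 1 := (con 1 :+ m) :* con 1) refl m)
  where open +-*-Solver
binomial m (suc q) = begin
  m ^ suc (suc q) + suc (suc q) * m ^ suc q                 ≤⟨ m≤m+n _ (suc q * m ^ q) ⟩
  m ^ suc (suc q) + suc (suc q) * m ^ suc q + suc q * m ^ q ≡⟨ expand m (m ^ q) q ⟩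
  suc m * (m ^ suc q + suc q * m ^ q)                       ≤⟨ *-monoʳ-≤ (suc m) (binomial m q) ⟩
  suc m ^ suc (suc q)                                       ∎
  where
  open ≤-Reasoning
  open +-*-Solver
  expand : ∀ m x q → m * (m * x) + (2 + q) * (m * x) + (1 + q) * x ≡ (1 + m) * (m * x + (1 + q) * x)
  expand = solve 3 (λ m x q → m :* (m :* x) :+ (con 2 :+ q) :* (m :* x) :+ (con 1 :+ q) :* x
                              := (con 1 :+ m) :* (m :* x :+ (con 1 :+ q) :* x)) refl

classes-bound : ∀ m s → classes m s ≤ m ^ s
classes-bound zero    zero    = ≤-refl
classes-bound zero    (suc s) = z≤n
classes-bound (suc m) zero    = ≤-trans (≤-reflexive (+-identityʳ _)) (classes-bound m zero)
classes-bound (suc m) (suc q) = begin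
  classes m (suc q) + ∑ (suc q) (splitCount m (suc q)) ≤⟨ +-mono-≤ (classes-bound m (suc q)) (∑-≤ _ split-bound) ⟩
  m ^ suc q + suc q * m ^ q                           ≤⟨ binomial m q ⟩
  suc m ^ suc q                                       ∎
  where
  open ≤-Reasoning
  split-bound : ∀ i → splitCount m (suc q) i ≤ m ^ q
  split-bound i = begin
    classes m (toℕ i) * classes m (rest i) ≤⟨ *-mono-≤ (classes-bound m (toℕ i)) (classes-bound m (rest i)) ⟩
    m ^ toℕ i * m ^ rest i                 ≡⟨ sym (^-distribˡ-+-* m (toℕ i) (rest i)) ⟩
    m ^ (toℕ i + rest i)                   ≡⟨ cong (m ^_) (rest-sum i) ⟩
    m ^ q                                  ∎

V≡2^ : ∀ m → V m ≡ 2 ^ m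
V≡2^ zero    = refl
V≡2^ (suc m) = cong₂ _+_ (V≡2^ m) (trans (V≡2^ m) (sym (+-identityʳ _)))

-- The colouring of all subsets of the level-m vertices: an (s+1)-set gets its class,
-- any other set the fixed colour j₀.
colouring : ∀ m s → Fin (classes m s) → Subset (V m) → Fin (classes m s)
colouring m s j₀ S with ∣ S ∣ ≟ suc s
... | yes size = proj₁ (classify m s S size)
... | no  _    = j₀

colouring-inClass : ∀ m s j₀ S → ∣ S ∣ ≡ suc s → InClass m s S (colouring m s j₀ S)
colouring-inClass m s j₀ S size with ∣ S ∣ ≟ suc s
... | yes size′ = proj₂ (classify m s S size′)
... | no  ¬size = ⊥-elim (¬size size)

Class⇒InClass : ∀ {m s j₀ j S} → Class (suc s) (colouring m s j₀) j S → InClass m s S j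
Class⇒InClass {m} {s} {j₀} {S = S} (size , colour≡j) =
  subst (InClass m s S) colour≡j (colouring-inClass m s j₀ S size)

InClass⇒Class : ∀ {m s j₀ j S} → InClass m s S j → Class (suc s) (colouring m s j₀) j S
InClass⇒Class {m} {s} {j₀} {S = S} h =
  inClass-size h , inClass-unique (colouring-inClass m s j₀ S (inClass-size h)) h refl

GoodPartition : ℕ → ℕ → ℕ → Set
GoodPartition m k N = Σ ℕ λ c → (c ≤ m ^ (k ∸ 2)) ×
  Σ (Subset N → Fin c) λ col →
    (∀ (j : Fin c) (v : Fin N) → Σ (Subset N) λ s → Class (k ∸ 1) col j s × v ∈ s) ×
    (∀ (j : Fin c) (t : ℕ) → t ≤ k → ¬ ContainsSemicycle (k ∸ 1) (Class (k ∸ 1) col j) t)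

good-partition : ∀ m s → suc s ≤ V m → GoodPartition m (suc (suc s)) (V m)
good-partition m s s<V = classes m s , classes-bound m s , col , covers , no-short-semicycle
  where
  j₀ : Fin (classes m s)
  j₀ = let (S , size) = subsetOfSize (suc s) s<V in proj₁ (classify m s S size)
  col : Subset (V m) → Fin (classes m s)
  col = colouring m s j₀
  covers : ∀ j v → Σ (Subset (V m)) λ S → Class (suc s) col j S × v ∈ S
  covers j v = let (S , h , v∈S) = cover m s j v in S , InClass⇒Class h , v∈S
  no-short-semicycle : ∀ j t → t ≤ suc (suc s) → ¬ ContainsSemicycle (suc s) (Class (suc s) col j) t
  no-short-semicycle j = rainbow⇒no-short-semicycle (suc s) (Class (suc s) col j) (label m s j)
    λ S h → inClass-rainbow (Class⇒InClass h)

lemma1 : (m k : ℕ) → 2 ≤ k → k ∸ 1 ≤ 2 ^ m →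
    Σ ℕ λ c → (c ≤ m ^ (k ∸ 2)) ×
      Σ (Subset (2 ^ m) → Fin c) λ col →
        (∀ (j : Fin c) (v : Fin (2 ^ m)) →
           Σ (Subset (2 ^ m)) λ s → Class (k ∸ 1) col j s × v ∈ s) ×
        (∀ (j : Fin c) (t : ℕ) → t ≤ k →
           ¬ ContainsSemicycle (k ∸ 1) (Class (k ∸ 1) col j) t)
lemma1 m (suc zero)    (s≤s ()) _
lemma1 m (suc (suc s)) _ s<2^m =
  subst (GoodPartition m (suc (suc s))) (V≡2^ m) (good-partition m s (subst (suc s ≤_) (sym (V≡2^ m)) s<2^m))
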